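{- In System $\mathsf{F}_\wedge$, if $\Theta,\Theta'\vdash S_-'<:S_-$ and $\Theta,\Theta'\vdash S_+<:S_+'$, then for any $\mathsf{F}_\wedge$-type $\Theta,X<:\top\vdash T$ we have $\Theta,\Theta'\vdash T[(S_-,S_+)/X]<:T[(S_-',S_+')/X]$.
   Context: System $\mathsf{F}_\wedge$. Types: $T ::= \top\mid X\mid T\to T\mid\forall X.T\mid T\wedge T$ (up to $\alpha$-conversion). Contexts are finite sequences of assumptions $X<:T$ and $x:T$ with the usual well-formedness judgment. Subtyping $\Theta\vdash S<:T$ is generated by: (Var) $\Theta,X<:T,\Theta'\vdash X<:T$; (Top) $\Theta\vdash T<:\top$; (Refl); (Trans); ($\to$) from $\Theta\vdash S'<:S$, $\Theta\vdash T<:T'$ infer $\Theta\vdash S\to T<:S'\to T'$; ($\forall$) from $\Theta,X<:\top\vdash S<:T$ infer $\Theta\vdash\forall X.S<:\forall X.T$; $S\wedge S'<:S$; $S\wedge S'<:S'$; $T<:S\wedge S'$ from $T<:S$ and $T<:S'$. Mixed substitution $T[(S_-,S_+)/X]$ (assuming by $\alpha$-conversion that neither $X$ nor free variables of $S_-,S_+$ are bound in $T$): $X[(S_-,S_+)/X]=S_+$; $Y[(S_-,S_+)/X]=Y$ for $Y\not\equiv X$; $\top[(S_-,S_+)/X]=\top$; $(T\to T')[(S_-,S_+)/X]=T[(S_+,S_-)/X]\to T'[(S_-,S_+)/X]$; $(\forall Y.T)[(S_-,S_+)/X]=\forall Y.T[(S_-,S_+)/X]$; $(T\wedge T')[(S_-,S_+)/X]=T[(S_-,S_+)/X]\wedge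 T'[(S_-,S_+)/X]$. -}

module Defs where

-- Types in scope n
-- may refer to any of the n entries by index (0 = most recent); the
-- well-formedness judgment requires variables to point at type-variable entries.

open import Data.Nat using (ℕ; zero; suc; _+_)
open import Data.Fin using (Fin; zero; suc; _↑ʳ_)

infixr 7 _⇒_
infixr 8 _∧_

data Ty (n : ℕ) : Set where
  top  : Ty n
  var  : Fin n → Ty n
  _⇒_  : Ty n → Ty n → Ty n
  ∀'   : Ty (suc n) → Ty n          -- ∀X.T  (X is index 0 in T)
  _∧_  : Ty n → Ty n → Ty n

extR : ∀ {n m} → (Fin n → Fin m) → Fin (suc n) → Fin (suc m)
extR ρ zero    = zero
extR ρ (suc i) = suc (ρ i)

rename : ∀ {n m} → (Fin n → Fin m) → Ty n → Ty m
rename ρ top      = top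
rename ρ (var x)  = var (ρ x)
rename ρ (A ⇒ B)  = rename ρ A ⇒ rename ρ B
rename ρ (∀' A)   = ∀' (rename (extR ρ) A)
rename ρ (A ∧ B)  = rename ρ A ∧ rename ρ B

wk : ∀ {n} → Ty n → Ty (suc n)
wk = rename suc

infixl 5 _,<:_ _,∶_
data Ctx : ℕ → Set where
  ε     : Ctx 0
  _,<:_ : ∀ {n} → Ctx n → Ty n → Ctx (suc n)
  _,∶_  : ∀ {n} → Ctx n → Ty n → Ctx (suc n)

data CtxExt (m : ℕ) : ℕ → Set where
  []    : CtxExt m 0
  _,<:_ : ∀ {k} → CtxExt m k → Ty (k + m) → CtxExt m (suc k)
  _,∶_  : ∀ {k} → CtxExt m k → Ty (k + m) → CtxExt m (suc k)

infixl 4 _++_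
_++_ : ∀ {m k} → Ctx m → CtxExt m k → Ctx (k + m)
Θ ++ []         = Θ
Θ ++ (Θ' ,<: T) = (Θ ++ Θ') ,<: T
Θ ++ (Θ' ,∶ T)  = (Θ ++ Θ') ,∶ T

infix 4 _∋_<:_
data _∋_<:_ : ∀ {n} → Ctx n → Fin n → Ty n → Set where
  here    : ∀ {n} {Γ : Ctx n} {T} → (Γ ,<: T) ∋ zero <: wk T
  there<: : ∀ {n} {Γ : Ctx n} {x T U} → Γ ∋ x <: T → (Γ ,<: U) ∋ suc x <: wk T
  there∶  : ∀ {n} {Γ : Ctx n} {x T U} → Γ ∋ x <: T → (Γ ,∶ U) ∋ suc x <: wk T

infix 4 _⊢_wf ⊢_ok
data _⊢_wf : ∀ {n} → Ctx n → Ty n → Set where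
  wf-top : ∀ {n} {Γ : Ctx n} → Γ ⊢ top wf
  wf-var : ∀ {n} {Γ : Ctx n} {x T} → Γ ∋ x <: T → Γ ⊢ var x wf
  wf-⇒   : ∀ {n} {Γ : Ctx n} {A B} → Γ ⊢ A wf → Γ ⊢ B wf → Γ ⊢ A ⇒ B wf
  wf-∀   : ∀ {n} {Γ : Ctx n} {A} → (Γ ,<: top) ⊢ A wf → Γ ⊢ ∀' A wf
  wf-∧   : ∀ {n} {Γ : Ctx n} {A B} → Γ ⊢ A wf → Γ ⊢ B wf → Γ ⊢ A ∧ B wf

data ⊢_ok : ∀ {n} → Ctx n → Set where
  ok-ε  : ⊢ ε ok
  ok-<: : ∀ {n} {Γ : Ctx n} {T} → ⊢ Γ ok → Γ ⊢ T wf → ⊢ (Γ ,<: T) ok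
  ok-∶  : ∀ {n} {Γ : Ctx n} {T} → ⊢ Γ ok → Γ ⊢ T wf → ⊢ (Γ ,∶ T) ok

infix 4 _⊢_<:_
data _⊢_<:_ : ∀ {n} → Ctx n → Ty n → Ty n → Set where
  S-Var   : ∀ {n} {Γ : Ctx n} {x T} → Γ ∋ x <: T → Γ ⊢ var x <: T
  S-Top   : ∀ {n} {Γ : Ctx n} {T} → Γ ⊢ T <: top
  S-Refl  : ∀ {n} {Γ : Ctx n} {T} → Γ ⊢ T <: T
  S-Trans : ∀ {n} {Γ : Ctx n} {S T U} → Γ ⊢ S <: T → Γ ⊢ T <: U → Γ ⊢ S <: U
  S-⇒     : ∀ {n} {Γ : Ctx n} {S S' T T'} → Γ ⊢ S' <: S → Γ ⊢ T <: T' → Γ ⊢ S ⇒ T <: S' ⇒ T'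
  S-∀     : ∀ {n} {Γ : Ctx n} {S T} → (Γ ,<: top) ⊢ S <: T → Γ ⊢ ∀' S <: ∀' T
  S-∧ˡ    : ∀ {n} {Γ : Ctx n} {S S'} → Γ ⊢ S ∧ S' <: S
  S-∧ʳ    : ∀ {n} {Γ : Ctx n} {S S'} → Γ ⊢ S ∧ S' <: S'
  S-∧     : ∀ {n} {Γ : Ctx n} {T S S'} → Γ ⊢ T <: S → Γ ⊢ T <: S' → Γ ⊢ T <: S ∧ S'

-- Mixed (polarity-sensitive) parallel substitution:
-- σ₋ is used at negative occurrences, σ₊ at positive ones.
exts : ∀ {n p} → (Fin n → Ty p) → Fin (suc n) → Ty (suc p)
exts σ zero    = var zero
exts σ (suc i) = wk (σ i)

msub : ∀ {n p} → (Fin n → Ty p) → (Fin n → Ty p) → Ty n → Ty p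
msub σ₋ σ₊ top     = top
msub σ₋ σ₊ (var x) = σ₊ x
msub σ₋ σ₊ (A ⇒ B) = msub σ₊ σ₋ A ⇒ msub σ₋ σ₊ B
msub σ₋ σ₊ (∀' A)  = ∀' (msub (exts σ₋) (exts σ₊) A)
msub σ₋ σ₊ (A ∧ B) = msub σ₋ σ₊ A ∧ msub σ₋ σ₊ B

-- For T in scope Θ, X (X = index 0) and S in scope Θ,Θ' (|Θ'| = k):
-- X ↦ S, and every variable Y of Θ ↦ Y (reindexed into Θ,Θ').
single : ∀ {m} k → Ty (k + m) → Fin (suc m) → Ty (k + m)
single k S zero    = S
single k S (suc i) = var (k ↑ʳ i)

-- T[(S₋,S₊)/X]  (k = length of Θ', determined by the types of S₋, S₊)
mixSub : ∀ {m} k → Ty (suc m) → Ty (k + m) → Ty (k + m) → Ty (k + m)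
mixSub k T S₋ S₊ = msub (single k S₋) (single k S₊) T

-- Mixed substitution is monotone: shrinking the instances at negative
-- occurrences and enlarging those at positive ones enlarges the result.  This
-- holds for arbitrary parallel mixed substitutions, by induction on the type:
-- at an arrow the two substitutions swap roles exactly as S-⇒ swaps the
-- direction of its domain premise, and under a binder one needs that
-- subtyping is stable under weakening.  The theorem is the instance that
-- substitutes for X and fixes every variable of Θ.

module Submission where

open import Defs
open import Data.Nat using (suc; _+_)
open import Data.Fin using (Fin; zero; suc)
open import Function using (_∘_)
open import Relation.Binary.PropositionalEquality
  using (_≡_; refl; cong; cong₂; subst; sym; trans)

rename-fusion : ∀ {n m p} (f : Fin m → Fin p) (g : Fin n → Fin m) (h : Fin n → Fin p)
              → (∀ x → f (g x) ≡ h x) → ∀ T → rename f (rename g T) ≡ rename h T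
rename-fusion f g h eq top     = refl
rename-fusion f g h eq (var x) = cong var (eq x)
rename-fusion f g h eq (A ⇒ B) = cong₂ _⇒_ (rename-fusion f g h eq A) (rename-fusion f g h eq B)
rename-fusion f g h eq (∀' A)  = cong ∀' (rename-fusion (extR f) (extR g) (extR h) eq′ A)
  where
  eq′ : ∀ x → extR f (extR g x) ≡ extR h x
  eq′ zero    = refl
  eq′ (suc x) = cong suc (eq x)
rename-fusion f g h eq (A ∧ B) = cong₂ _∧_ (rename-fusion f g h eq A) (rename-fusion f g h eq B)

rename-extR-wk : ∀ {n m} (ρ : Fin n → Fin m) T → rename (extR ρ) (wk T) ≡ wk (rename ρ T)
rename-extR-wk ρ T = trans (rename-fusion (extR ρ) suc (suc ∘ ρ) (λ _ → refl) T)
                           (sym (rename-fusion suc ρ (suc ∘ ρ) (λ _ → refl) T))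

BoundPreserving : ∀ {n m} → Ctx n → Ctx m → (Fin n → Fin m) → Set
BoundPreserving Γ Δ ρ = ∀ {x T} → Γ ∋ x <: T → Δ ∋ ρ x <: rename ρ T

extR-boundPreserving : ∀ {n m} {Γ : Ctx n} {Δ : Ctx m} {ρ} → BoundPreserving Γ Δ ρ
                     → BoundPreserving (Γ ,<: top) (Δ ,<: top) (extR ρ)
extR-boundPreserving bp here = here
extR-boundPreserving {ρ = ρ} bp (there<: {T = T} x<:T) =
  subst (_ ∋ _ <:_) (sym (rename-extR-wk ρ T)) (there<: (bp x<:T))

rename-<: : ∀ {n m} {Γ : Ctx n} {Δ : Ctx m} {ρ} → BoundPreserving Γ Δ ρ
          → ∀ {S T} → Γ ⊢ S <: T → Δ ⊢ rename ρ S <: rename ρ T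
rename-<: bp (S-Var x<:T)  = S-Var (bp x<:T)
rename-<: bp S-Top         = S-Top
rename-<: bp S-Refl        = S-Refl
rename-<: bp (S-Trans p q) = S-Trans (rename-<: bp p) (rename-<: bp q)
rename-<: bp (S-⇒ p q)     = S-⇒ (rename-<: bp p) (rename-<: bp q)
rename-<: bp (S-∀ p)       = S-∀ (rename-<: (extR-boundPreserving bp) p)
rename-<: bp S-∧ˡ          = S-∧ˡ
rename-<: bp S-∧ʳ          = S-∧ʳ
rename-<: bp (S-∧ p q)     = S-∧ (rename-<: bp p) (rename-<: bp q)

wk-<: : ∀ {n} {Γ : Ctx n} {U S T} → Γ ⊢ S <: T → (Γ ,<: U) ⊢ wk S <: wk T
wk-<: = rename-<: there<:

_⊢_≤ₛ_ : ∀ {n p} → Ctx p → (Fin n → Ty p) → (Fin n → Ty p) → Set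
Γ ⊢ σ ≤ₛ τ = ∀ i → Γ ⊢ σ i <: τ i

exts-mono : ∀ {n p} {Γ : Ctx p} {σ τ : Fin n → Ty p}
          → Γ ⊢ σ ≤ₛ τ → (Γ ,<: top) ⊢ exts σ ≤ₛ exts τ
exts-mono σ≤τ zero    = S-Refl
exts-mono σ≤τ (suc i) = wk-<: (σ≤τ i)

msub-mono : ∀ {n p} {Γ : Ctx p} {σ₋ σ₊ σ₋' σ₊' : Fin n → Ty p}
          → Γ ⊢ σ₋' ≤ₛ σ₋ → Γ ⊢ σ₊ ≤ₛ σ₊'
          → ∀ T → Γ ⊢ msub σ₋ σ₊ T <: msub σ₋' σ₊' T
msub-mono h₋ h₊ top     = S-Refl
msub-mono h₋ h₊ (var x) = h₊ x
msub-mono h₋ h₊ (A ⇒ B) = S-⇒ (msub-mono h₊ h₋ A) (msub-mono h₋ h₊ B)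
msub-mono h₋ h₊ (∀' A)  = S-∀ (msub-mono (exts-mono h₋) (exts-mono h₊) A)
msub-mono h₋ h₊ (A ∧ B) = S-∧ (S-Trans S-∧ˡ (msub-mono h₋ h₊ A))
                              (S-Trans S-∧ʳ (msub-mono h₋ h₊ B))

single-mono : ∀ {m k} {Γ : Ctx (k + m)} {S S' : Ty (k + m)}
            → Γ ⊢ S <: S' → Γ ⊢ single k S ≤ₛ single k S'
single-mono S<:S' zero    = S<:S'
single-mono S<:S' (suc i) = S-Refl

mainTheorem16 : ∀ {m k} (Θ : Ctx m) (Θ' : CtxExt m k)
                  (S₋ S₋' S₊ S₊' : Ty (k + m)) (T : Ty (suc m))
                  → ⊢ (Θ ,<: top) ok
                  → (Θ ,<: top) ⊢ T wf
                  → (Θ ++ Θ') ⊢ S₋' <: S₋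
                  → (Θ ++ Θ') ⊢ S₊ <: S₊'
                  → (Θ ++ Θ') ⊢ mixSub k T S₋ S₊ <: mixSub k T S₋' S₊'
-- Monotonicity holds for every raw type.
mainTheorem16 Θ Θ' S₋ S₋' S₊ S₊' T _ _ S₋'<:S₋ S₊<:S₊' =
  msub-mono (single-mono S₋'<:S₋) (single-mono S₊<:S₊') T
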